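{- Let $A$ be a finite set of agents and $\mathsf{AP}$ a countable set of atomic propositions. The proof system $\mathbf{SC}$ is sound with respect to the class of generalized simplicial models, i.e. every formula provable in $\mathbf{SC}$ is true in every world of every generalized simplicial model. Likewise, $\mathbf{SC}_{\min}$ is sound with respect to the class of minimal simplicial models, and $\mathbf{SC}_{\max}$ is sound with respect to the class of maximal simplicial models.
   Context: A chromatic simplicial complex is a triple $\langle V,S,\chi\rangle$ where $V$ is a set, $S$ is a family of non-empty subsets of $V$ containing every singleton $\{v\}$ and closed under taking non-empty subsets, and $\chi:V\to A$ assigns distinct colours to the vertices of every $X\in S$. Facets are the inclusion-maximal elements of $S$. A (generalized) simplicial model is $\mathcal C=\langle V,S,\chi,W,\ell\rangle$ where $\langle V,S,\chi\rangle$ is a chromatic simplicial complex, $W$ (the worlds) satisfies $\mathrm{Facets}(\mathcal C)\subseteq W\subseteq S$, and $\ell:W\to\mathcal P(\mathsf{AP})$. It is minimal if $W$ is exactly the set of facets and maximal if $W=S$. The language $\mathcal L_D$ is given by $\varphi::=p\mid\neg\varphi\mid\varphi\wedge\varphi\mid D_B\varphi$ with $p\in\mathsf{AP}$ and $\emptyset\neq B\subseteq A$; $\vee,\Rightarrow,\top,\bot$ are defined as usual, $K_a\varphi:=D_{\{a\}}\varphi$. Satisfaction: $\mathcal C,w\models p$ iff $p\in\ell(w)$; boolean clauses as usual; $\mathcal C,w\models D_B\varphi$ iff $\mathcal C,w'\models\varphi$ for all $w'\in W$ with $B\subseteq\chi(w\cap w')$. Abbreviations: $\mathsf{dead}(a):=K_a\bot$,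 $\mathsf{alive}(a):=\neg\mathsf{dead}(a)$, $\mathsf{dead}(B):=\bigwedge_{a\in B}\mathsf{dead}(a)$ (empty conjunction is $\top$), $\mathsf{alive}(B):=\neg D_B\bot$, and $\overline B:=A\setminus B$. $\mathbf{SC}$ consists of all propositional tautologies, modus ponens, necessitation (from $\varphi$ infer $D_B\varphi$), and the axioms (for all non-empty $B,B'\subseteq A$ and formulas $\varphi,\psi$): K: $D_B(\varphi\Rightarrow\psi)\Rightarrow(D_B\varphi\Rightarrow D_B\psi)$; B: $\varphi\Rightarrow D_B\neg D_B\neg\varphi$; 4: $D_B\varphi\Rightarrow D_BD_B\varphi$; Mono: $D_B\varphi\Rightarrow D_{B'}\varphi$ for $B\subseteq B'$; Union: $\mathsf{alive}(B)\wedge\mathsf{alive}(B')\Rightarrow\mathsf{alive}(B\cup B')$; NE: $\bigvee_{a\in A}\mathsf{alive}(a)$; P: $\mathsf{alive}(B)\wedge\mathsf{dead}(\overline B)\wedge\varphi\Rightarrow D_B(\mathsf{dead}(\overline B)\Rightarrow\varphi)$. $\mathbf{SC}_{\min}$ is $\mathbf{SC}$ plus Min: $\mathsf{alive}(B)\wedge\mathsf{dead}(\overline B)\Rightarrow D_B\,\mathsf{dead}(\overline B)$ for $B\subsetneq A$; $\mathbf{SC}_{\max}$ is $\mathbf{SC}$ plus Max: $\mathsf{alive}(B)\Rightarrow\neg D_B\neg\mathsf{dead}(\overline B)$ for $B\subsetneq A$. -}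

module Defs where

open import Level using (Level; Lift; _⊔_) renaming (suc to lsuc; zero to lzero)
open import Data.Nat using (ℕ)
open import Data.Bool using (Bool; true; false; not; _∧_; _∨_; if_then_else_)
open import Data.Fin using (Fin)
open import Data.Fin.Subset using (Subset; _∈_; _∉_; _⊆_; _⊂_; Nonempty; ⁅_⁆; ∁)
  renaming (⊤ to Full)
open import Data.Fin.Subset.Properties using (x∈⁅x⁆)
open import Data.Vec using (lookup)
open import Data.List using (List; foldr; allFin)
open import Data.Product using (Σ; ∃; _×_; _,_)
open import Data.Unit using (⊤)
open import Data.Empty using (⊥)
open import Relation.Nullary using (¬_)
open import Relation.Binary.PropositionalEquality using (_≡_)

-- Syntax of L_D over agents A = Fin n and atoms AP.
-- ⊤ is taken as primitive (AP may be empty, so it is not definable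
-- from atoms); ⊥, ∨, ⇒ are defined as usual.

data Fm (n : ℕ) (AP : Set) : Set where
  var : AP → Fm n AP
  tt  : Fm n AP
  ~_  : Fm n AP → Fm n AP
  _&_ : Fm n AP → Fm n AP → Fm n AP
  D   : (B : Subset n) → Nonempty B → Fm n AP → Fm n AP

infix  6 ~_
infixr 5 _&_

module _ {n : ℕ} {AP : Set} where

  infixr 4 _∣∣_
  infixr 3 _⇒_

  ff : Fm n AP
  ff = ~ tt

  _∣∣_ : Fm n AP → Fm n AP → Fm n AP
  φ ∣∣ ψ = ~ (~ φ & ~ ψ)

  _⇒_ : Fm n AP → Fm n AP → Fm n AP
  φ ⇒ ψ = ~ (φ & ~ ψ)

  K : Fin n → Fm n AP → Fm n AP
  K a φ = D ⁅ a ⁆ (a , x∈⁅x⁆ a) φ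

  dead : Fin n → Fm n AP
  dead a = K a ff

  alive : Fin n → Fm n AP
  alive a = ~ dead a

  deadSet : Subset n → Fm n AP
  deadSet B = foldr (λ a r → if lookup B a then (dead a & r) else r) tt (allFin n)

  aliveSet : (B : Subset n) → Nonempty B → Fm n AP
  aliveSet B ne = ~ D B ne ff

  someAlive : Fm n AP
  someAlive = foldr (λ a r → alive a ∣∣ r) ff (allFin n)

evalB : ∀ {n AP} → (Fm n AP → Bool) → Fm n AP → Bool
evalB v (var p)    = v (var p)
evalB v tt         = true
evalB v (~ φ)      = not (evalB v φ)
evalB v (φ & ψ)    = evalB v φ ∧ evalB v ψ
evalB v (D B ne φ) = v (D B ne φ)

Tautology : ∀ {n AP} → Fm n AP → Set
Tautology φ = ∀ v → evalB v φ ≡ true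

data Sys : Set where
  SC SCmin SCmax : Sys

data Prov {n : ℕ} {AP : Set} (L : Sys) : Fm n AP → Set where
  taut  : ∀ {φ} → Tautology φ → Prov L φ
  mp    : ∀ {φ ψ} → Prov L (φ ⇒ ψ) → Prov L φ → Prov L ψ
  nec   : ∀ {φ} (B : Subset n) (ne : Nonempty B) → Prov L φ → Prov L (D B ne φ)
  axK   : ∀ (B : Subset n) (ne : Nonempty B) φ ψ →
          Prov L (D B ne (φ ⇒ ψ) ⇒ (D B ne φ ⇒ D B ne ψ))
  axB   : ∀ (B : Subset n) (ne : Nonempty B) φ →
          Prov L (φ ⇒ D B ne (~ D B ne (~ φ)))
  ax4   : ∀ (B : Subset n) (ne : Nonempty B) φ →
          Prov L (D B ne φ ⇒ D B ne (D B ne φ))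
  mono  : ∀ (B B' : Subset n) (ne : Nonempty B) (ne' : Nonempty B') φ →
          B ⊆ B' → Prov L (D B ne φ ⇒ D B' ne' φ)
  union : ∀ (B B' : Subset n) (ne : Nonempty B) (ne' : Nonempty B')
            (ne'' : Nonempty (B Data.Fin.Subset.∪ B')) →
          Prov L (aliveSet B ne & aliveSet B' ne' ⇒ aliveSet (B Data.Fin.Subset.∪ B') ne'')
  axNE  : Prov L someAlive
  axP   : ∀ (B : Subset n) (ne : Nonempty B) φ →
          Prov L (aliveSet B ne & deadSet (∁ B) & φ ⇒ D B ne (deadSet (∁ B) ⇒ φ))
  axMin : L ≡ SCmin → ∀ (B : Subset n) (ne : Nonempty B) → B ⊂ Full →
          Prov L (aliveSet B ne & deadSet (∁ B) ⇒ D B ne (deadSet (∁ B)))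
  axMax : L ≡ SCmax → ∀ (B : Subset n) (ne : Nonempty B) → B ⊂ Full →
          Prov L (aliveSet B ne ⇒ ~ D B ne (~ deadSet (∁ B)))

-- Generalized simplicial models.  Vertex sets are predicates on V;
-- sets are identified up to extensional equality (_≐_).

Pred : Set → Set₁
Pred V = V → Set

_⊑_ : ∀ {V} → Pred V → Pred V → Set
X ⊑ Y = ∀ v → X v → Y v

_≐_ : ∀ {V} → Pred V → Pred V → Set
X ≐ Y = X ⊑ Y × Y ⊑ X

record SModel (n : ℕ) (AP : Set) : Set₁ where
  field
    V  : Set
    S  : Pred V → Set
    χ  : V → Fin n
    W  : Pred V → Set
    ℓ  : Pred V → AP → Bool
    S-nonempty : ∀ X → S X → ∃ λ v → X v
    S-single   : ∀ v → S (λ u → u ≡ v)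
    S-down     : ∀ X Y → S X → Y ⊑ X → (∃ λ v → Y v) → S Y
    chromatic  : ∀ X → S X → ∀ u v → X u → X v → χ u ≡ χ v → u ≡ v
    ℓ-ext      : ∀ X Y → X ≐ Y → ∀ p → ℓ X p ≡ ℓ Y p

  IsFacet : Pred V → Set₁
  IsFacet X = S X × (∀ Y → S Y → X ⊑ Y → Y ⊑ X)

  field
    facets⊆W : ∀ X → IsFacet X → W X
    W⊆S      : ∀ X → W X → S X

  Shares : Subset n → Pred V → Pred V → Set
  Shares B w w' = ∀ b → b ∈ B → ∃ λ v → w v × w' v × χ v ≡ b

open SModel public

Minimal : ∀ {n AP} → SModel n AP → Set₁
Minimal M = ∀ X → (W M X → IsFacet M X) × (IsFacet M X → W M X)

Maximal : ∀ {n AP} → SModel n AP → Set₁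
Maximal M = ∀ X → (W M X → S M X) × (S M X → W M X)

Sat : ∀ {n AP} (M : SModel n AP) → Pred (V M) → Fm n AP → Set₁
Sat M w (var p)    = Lift _ (ℓ M w p ≡ true)
Sat M w tt         = Lift _ ⊤
Sat M w (~ φ)      = ¬ Sat M w φ
Sat M w (φ & ψ)    = Sat M w φ × Sat M w ψ
Sat M w (D B _ φ)  = ∀ w' → W M w' → Shares M B w w' → Sat M w' φ

Valid : ∀ {n AP} → SModel n AP → Fm n AP → Set₁
Valid M φ = ∀ w → W M w → Sat M w φ

module Submission where

-- The geometric content lies in the colours of vertices: a world w satisfies
-- dead(∁B) iff all its vertices have colours in B, and then, by chromaticity,
-- every world w′ with B ⊆ χ(w ∩ w′) contains w.  This makes the two worlds in
-- axiom P equal, gives Min because a facet has no proper extension, and for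
-- Max the B-coloured face of w is itself a world.
-- Satisfaction is intuitionistic, but every w ⊨ φ is ¬¬-stable.  So for a
-- tautology one may, under a double negation, decide the finitely many atoms
-- of φ and evaluate φ under the resulting boolean valuation; building that
-- valuation needs decidable equality of formulas, which is what AP ↣ ℕ gives.

open import Defs
open import Level using (Level; lift)
open import Data.Nat using (ℕ)
open import Data.Nat.Properties using () renaming (_≟_ to _≟ℕ_)
open import Data.Bool using (Bool; true; false; if_then_else_)
open import Data.Bool.Properties using () renaming (_≟_ to _≟ᵇ_)
open import Data.Fin using (Fin)
open import Data.Fin.Properties using () renaming (_≟_ to _≟ᶠ_)
open import Data.Fin.Subset using (Subset; _∈_; _⊆_; ∁; _∪_; Nonempty)
open import Data.Fin.Subset.Properties using (x∈⁅x⁆; x∈⁅y⁆⇒x≡y; x∉p⇒x∈∁p; x∈∁p⇒x∉p; x∈p∪q⁻)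
  renaming (_∈?_ to _∈ˢ?_)
open import Data.Vec using (lookup)
open import Data.Vec.Properties using ([]=⇒lookup; lookup⇒[]=) renaming (≡-dec to ≡-dec-Vec)
open import Data.Vec.Properties.WithK using ([]=-irrelevant)
open import Data.List using (List; []; _∷_; _++_; foldr; allFin)
open import Data.List.Relation.Unary.All as All using (All; []; _∷_)
open import Data.List.Membership.Propositional using () renaming (_∈_ to _∈ₗ_)
open import Data.List.Membership.Propositional.Properties using (∈-allFin; ∈-++⁺ˡ; ∈-++⁺ʳ)
open import Data.List.Relation.Unary.Any using (here; there)
open import Data.Product using (_×_; _,_; proj₁; proj₂; uncurry)
open import Data.Product.Properties using () renaming (≡-dec to ≡-dec-Σ)
open import Data.Sum using ([_,_])
open import Data.Empty using (⊥-elim)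
open import Function using (_∘_)
open import Function.Bundles using (_↣_)
open import Relation.Nullary using (¬_; contradiction)
open import Relation.Nullary.Decidable using (Dec; yes; no; does; proof; map′; _×-dec_; ¬¬-excluded-middle; via-injection)
open import Relation.Nullary.Negation using (¬¬-map; negated-stable)
open import Relation.Nullary.Reflects using (Reflects; ofʸ; invert; ¬-reflects; _×-reflects_)
open import Relation.Binary.Definitions using (DecidableEquality)
open import Relation.Binary.PropositionalEquality using (_≡_; _≢_; refl; sym; trans; subst; cong; cong₂)

module _ {a p : Level} {A : Set a} where

  ¬¬-decideAll : (P : A → Set p) (xs : List A) → ¬ ¬ All (Dec ∘ P) xs
  ¬¬-decideAll P []       k = k []
  ¬¬-decideAll P (x ∷ xs) k = ¬¬-excluded-middle λ d → ¬¬-decideAll P xs (k ∘ (d ∷_))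

  module _ (_≟_ : DecidableEquality A) {P : A → Set p} where

    open import Data.List.Membership.DecPropositional _≟_ using (_∈?_)

    decisionsToBool : ∀ {xs} → All (Dec ∘ P) xs → A → Bool
    decisionsToBool {xs} ds x with x ∈? xs
    ... | yes x∈xs = does (All.lookup ds x∈xs)
    ... | no _     = false

    decisionsToBool-reflects : ∀ {xs} (ds : All (Dec ∘ P) xs) {x} →
                               x ∈ₗ xs → Reflects (P x) (decisionsToBool ds x)
    decisionsToBool-reflects {xs} ds {x} x∈xs with x ∈? xs
    ... | yes x∈xs′ = proof (All.lookup ds x∈xs′)
    ... | no x∉xs   = contradiction x∈xs x∉xs

module _ {n : ℕ} {AP : Set} (_≟ₐ_ : DecidableEquality AP) where

  private
    _≟ₛ_ : DecidableEquality (Subset n)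
    _≟ₛ_ = ≡-dec-Vec _≟ᵇ_

    _≟ₙ_ : ∀ {B : Subset n} → DecidableEquality (Nonempty B)
    _≟ₙ_ = ≡-dec-Σ _≟ᶠ_ (λ x∈B y∈B → yes ([]=-irrelevant x∈B y∈B))

  infix 4 _≟ᶠᵐ_
  _≟ᶠᵐ_ : DecidableEquality (Fm n AP)
  var p ≟ᶠᵐ var q = map′ (cong var) (λ { refl → refl }) (p ≟ₐ q)
  tt ≟ᶠᵐ tt = yes refl
  ~ φ ≟ᶠᵐ ~ ψ = map′ (cong ~_) (λ { refl → refl }) (φ ≟ᶠᵐ ψ)
  (φ & φ′) ≟ᶠᵐ (ψ & ψ′) =
    map′ (uncurry (cong₂ _&_)) (λ { refl → refl , refl }) (φ ≟ᶠᵐ ψ ×-dec φ′ ≟ᶠᵐ ψ′)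
  D B ne φ ≟ᶠᵐ D C ne′ ψ with B ≟ₛ C
  ... | no B≢C  = no λ { refl → B≢C refl }
  ... | yes refl =
    map′ (λ { (refl , refl) → refl }) (λ { refl → refl , refl }) (ne ≟ₙ ne′ ×-dec φ ≟ᶠᵐ ψ)
  var _ ≟ᶠᵐ tt = no λ ()
  var _ ≟ᶠᵐ ~ _ = no λ ()
  var _ ≟ᶠᵐ _ & _ = no λ ()
  var _ ≟ᶠᵐ D _ _ _ = no λ ()
  tt ≟ᶠᵐ var _ = no λ ()
  tt ≟ᶠᵐ ~ _ = no λ ()
  tt ≟ᶠᵐ _ & _ = no λ ()
  tt ≟ᶠᵐ D _ _ _ = no λ ()
  ~ _ ≟ᶠᵐ var _ = no λ ()
  ~ _ ≟ᶠᵐ tt = no λ ()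
  ~ _ ≟ᶠᵐ _ & _ = no λ ()
  ~ _ ≟ᶠᵐ D _ _ _ = no λ ()
  _ & _ ≟ᶠᵐ var _ = no λ ()
  _ & _ ≟ᶠᵐ tt = no λ ()
  _ & _ ≟ᶠᵐ ~ _ = no λ ()
  _ & _ ≟ᶠᵐ D _ _ _ = no λ ()
  D _ _ _ ≟ᶠᵐ var _ = no λ ()
  D _ _ _ ≟ᶠᵐ tt = no λ ()
  D _ _ _ ≟ᶠᵐ ~ _ = no λ ()
  D _ _ _ ≟ᶠᵐ _ & _ = no λ ()

atoms : ∀ {n AP} → Fm n AP → List (Fm n AP)
atoms (var p)    = var p ∷ []
atoms tt         = []
atoms (~ φ)      = atoms φ
atoms (φ & ψ)    = atoms φ ++ atoms ψ
atoms (D B ne φ) = D B ne φ ∷ []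

module Semantics {n : ℕ} {AP : Set} (M : SModel n AP) where

  infix 2 _⊨_
  _⊨_ : Pred (V M) → Fm n AP → Set₁
  w ⊨ φ = Sat M w φ

  ⊨-stable : ∀ {w} φ → ¬ ¬ (w ⊨ φ) → w ⊨ φ
  ⊨-stable {w} (var p) ¬¬p with ℓ M w p
  ... | true  = lift refl
  ... | false = ⊥-elim (¬¬p λ { (lift ()) })
  ⊨-stable tt         _     = lift _
  ⊨-stable (~ φ)      ¬¬¬φ  = negated-stable ¬¬¬φ
  ⊨-stable (φ & ψ)    ¬¬φψ  = ⊨-stable φ (¬¬-map proj₁ ¬¬φψ) , ⊨-stable ψ (¬¬-map proj₂ ¬¬φψ)
  ⊨-stable (D B _ φ)  ¬¬□φ w′ Ww′ sh = ⊨-stable φ (¬¬-map (λ □φ → □φ w′ Ww′ sh) ¬¬□φ)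

  ⇒-elim : ∀ {w φ} ψ → w ⊨ φ ⇒ ψ → w ⊨ φ → w ⊨ ψ
  ⇒-elim ψ φ⇒ψ wφ = ⊨-stable ψ λ ¬wψ → φ⇒ψ (wφ , ¬wψ)

  evalB-reflects : ∀ {w} (v : Fm n AP → Bool) φ →
                   (∀ {α} → α ∈ₗ atoms φ → Reflects (w ⊨ α) (v α)) →
                   Reflects (w ⊨ φ) (evalB v φ)
  evalB-reflects v (var p)    r = r (here refl)
  evalB-reflects v tt         r = ofʸ (lift _)
  evalB-reflects v (~ φ)      r = ¬-reflects (evalB-reflects v φ r)
  evalB-reflects v (φ & ψ)    r =
    evalB-reflects v φ (r ∘ ∈-++⁺ˡ) ×-reflects evalB-reflects v ψ (r ∘ ∈-++⁺ʳ (atoms φ))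
  evalB-reflects v (D B ne φ) r = r (here refl)

  tautology-valid : DecidableEquality (Fm n AP) → ∀ {φ} → Tautology φ → Valid M φ
  tautology-valid _≟_ {φ} tautφ w _ = ⊨-stable φ λ ¬wφ →
    ¬¬-decideAll (w ⊨_) (atoms φ) λ ds →
      let v = decisionsToBool _≟_ ds
      in ¬wφ (invert (subst (Reflects (w ⊨ φ)) (tautφ v)
                            (evalB-reflects v φ (decisionsToBool-reflects _≟_ ds))))

  module _ {B : Subset n} where

    Shares-sym : ∀ {w w′} → Shares M B w w′ → Shares M B w′ w
    Shares-sym sh b b∈B with sh b b∈B
    ... | v , wv , w′v , χv≡b = v , w′v , wv , χv≡b

    Shares-trans : ∀ {w w′ w″} → S M w′ → Shares M B w w′ → Shares M B w′ w″ → Shares M B w w″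
    Shares-trans {w′ = w′} Sw′ sh sh′ b b∈B with sh b b∈B | sh′ b b∈B
    ... | v , wv , w′v , χv≡b | u , w′u , w″u , χu≡b
      with chromatic M w′ Sw′ v u w′v w′u (trans χv≡b (sym χu≡b))
    ... | refl = v , wv , w″u , χv≡b

    Shares-⊑ˡ : ∀ {w w′ w″} → w ⊑ w′ → Shares M B w w″ → Shares M B w′ w″
    Shares-⊑ˡ w⊑w′ sh b b∈B with sh b b∈B
    ... | v , wv , w″v , χv≡b = v , w⊑w′ v wv , w″v , χv≡b

    Shares-reflˡ : ∀ {w w′} → Shares M B w w′ → Shares M B w w
    Shares-reflˡ sh b b∈B with sh b b∈B
    ... | v , wv , _ , χv≡b = v , wv , wv , χv≡b

  Shares-antimono : ∀ {B B′ w w′} → B ⊆ B′ → Shares M B′ w w′ → Shares M B w w′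
  Shares-antimono B⊆B′ sh b b∈B = sh b (B⊆B′ b∈B)

  Shares-∪ : ∀ {B B′ w w′} → Shares M B w w′ → Shares M B′ w w′ → Shares M (B ∪ B′) w w′
  Shares-∪ {B} {B′} sh sh′ b b∈B∪B′ = [ sh b , sh′ b ] (x∈p∪q⁻ B B′ b∈B∪B′)

  ⊨-resp-≐ : ∀ φ {w w′} → w ≐ w′ → w ⊨ φ → w′ ⊨ φ
  ⊨-resp-≐ (var p)    {w} {w′} w≐w′ (lift ℓp) = lift (trans (sym (ℓ-ext M w w′ w≐w′ p)) ℓp)
  ⊨-resp-≐ tt         _                 wφ        = wφ
  ⊨-resp-≐ (~ φ)      (w⊑w′ , w′⊑w)     ¬wφ w′φ   = ¬wφ (⊨-resp-≐ φ (w′⊑w , w⊑w′) w′φ)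
  ⊨-resp-≐ (φ & ψ)    w≐w′              (wφ , wψ) = ⊨-resp-≐ φ w≐w′ wφ , ⊨-resp-≐ ψ w≐w′ wψ
  ⊨-resp-≐ (D B _ φ)  (_ , w′⊑w)        □φ w″ Ww″ sh = □φ w″ Ww″ (Shares-⊑ˡ w′⊑w sh)

  ColoursWithin : Pred (V M) → Subset n → Set
  ColoursWithin w B = ∀ v → w v → χ M v ∈ B

  Shares⇒⊑ : ∀ {B w w′} → S M w → ColoursWithin w B → Shares M B w w′ → w ⊑ w′
  Shares⇒⊑ {w = w} Sw χw⊆B sh v wv with sh (χ M v) (χw⊆B v wv)
  ... | u , wu , w′u , χu≡χv with chromatic M w Sw u v wu wv χu≡χv
  ... | refl = w′u

  dead⇒colour≢ : ∀ {w a} → W M w → w ⊨ dead a → ∀ v → w v → χ M v ≢ a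
  dead⇒colour≢ {w} {a} Ww □⊥ v wv χv≡a =
    □⊥ w Ww (λ b b∈⁅a⁆ → v , wv , wv , trans χv≡a (sym (x∈⁅y⁆⇒x≡y a b∈⁅a⁆))) (lift _)

  colour≢⇒dead : ∀ {w a} → (∀ v → w v → χ M v ≢ a) → w ⊨ dead a
  colour≢⇒dead {a = a} χw∌a w′ _ sh _ with sh a (x∈⁅x⁆ a)
  ... | v , wv , _ , χv≡a = χw∌a v wv χv≡a

  deadAmong : Subset n → List (Fin n) → Fm n AP
  deadAmong C = foldr (λ a r → if lookup C a then (dead a & r) else r) tt

  deadAmong⁺ : ∀ {w} C xs → (∀ {a} → a ∈ C → w ⊨ dead a) → w ⊨ deadAmong C xs
  deadAmong⁺ C []       _    = lift _
  deadAmong⁺ C (x ∷ xs) dead with lookup C x in C[x]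
  ... | true  = dead (lookup⇒[]= x C C[x]) , deadAmong⁺ C xs dead
  ... | false = deadAmong⁺ C xs dead

  deadAmong⁻ : ∀ {w} C xs → w ⊨ deadAmong C xs → All (λ a → a ∈ C → w ⊨ dead a) xs
  deadAmong⁻ C []       _ = []
  deadAmong⁻ C (x ∷ xs) wdead with lookup C x in C[x]
  ... | true  = (λ _ → proj₁ wdead) ∷ deadAmong⁻ C xs (proj₂ wdead)
  ... | false = (λ x∈C → contradiction (trans (sym ([]=⇒lookup x∈C)) C[x]) λ ())
                ∷ deadAmong⁻ C xs wdead

  deadSet⁺ : ∀ {w} C → (∀ {a} → a ∈ C → w ⊨ dead a) → w ⊨ deadSet C
  deadSet⁺ C = deadAmong⁺ C (allFin n)

  deadSet⁻ : ∀ {w a} C → w ⊨ deadSet C → a ∈ C → w ⊨ dead a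
  deadSet⁻ {a = a} C wdead = All.lookup (deadAmong⁻ C (allFin n) wdead) (∈-allFin a)

  deadSet∁⇒ColoursWithin : ∀ {w} B → W M w → w ⊨ deadSet (∁ B) → ColoursWithin w B
  deadSet∁⇒ColoursWithin B Ww wdead v wv with χ M v ∈ˢ? B
  ... | yes χv∈B = χv∈B
  ... | no  χv∉B = ⊥-elim (dead⇒colour≢ Ww (deadSet⁻ (∁ B) wdead (x∉p⇒x∈∁p χv∉B)) v wv refl)

  ColoursWithin⇒deadSet∁ : ∀ {w} B → ColoursWithin w B → w ⊨ deadSet (∁ B)
  ColoursWithin⇒deadSet∁ B χw⊆B =
    deadSet⁺ (∁ B) λ a∈∁B → colour≢⇒dead λ { v wv refl → x∈∁p⇒x∉p a∈∁B (χw⊆B v wv) }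

  aliveSet⇒¬¬Shares : ∀ {w} B ne → w ⊨ aliveSet B ne → ¬ ¬ Shares M B w w
  aliveSet⇒¬¬Shares _ _ alive ¬sh = alive λ _ _ sh _ → ¬sh (Shares-reflˡ sh)

  Shares⇒aliveSet : ∀ {w} B ne → W M w → Shares M B w w → w ⊨ aliveSet B ne
  Shares⇒aliveSet {w} _ _ Ww sh □⊥ = □⊥ w Ww sh (lift _)

  _↾_ : Pred (V M) → Subset n → Pred (V M)
  (w ↾ B) v = w v × χ M v ∈ B

  Shares-↾ : ∀ {w B} → Shares M B w w → Shares M B w (w ↾ B)
  Shares-↾ sh b b∈B with sh b b∈B
  ... | v , wv , _ , refl = v , wv , (wv , b∈B) , refl

  ↾-face : ∀ {w B} → S M w → Nonempty B → Shares M B w w → S M (w ↾ B)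
  ↾-face {w} {B} Sw (b , b∈B) sh with sh b b∈B
  ... | v , wv , _ , refl = S-down M w (w ↾ B) Sw (λ _ → proj₁) (v , wv , b∈B)

  axUnion-valid : ∀ B B′ ne ne′ ne″ → Valid M (aliveSet B ne & aliveSet B′ ne′ ⇒ aliveSet (B ∪ B′) ne″)
  axUnion-valid B B′ ne ne′ ne″ w Ww ((aliveB , aliveB′) , ¬aliveB∪B′) =
    aliveSet⇒¬¬Shares B ne aliveB λ sh → aliveSet⇒¬¬Shares B′ ne′ aliveB′ λ sh′ →
      ¬aliveB∪B′ (Shares⇒aliveSet (B ∪ B′) ne″ Ww (Shares-∪ sh sh′))

  axNE-valid : Valid M someAlive
  axNE-valid w Ww with S-nonempty M w (W⊆S M w Ww)
  ... | v , wv = alive-among (∈-allFin (χ M v)) (λ dead → dead⇒colour≢ Ww dead v wv refl)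
    where
      alive-among : ∀ {a xs} → a ∈ₗ xs → w ⊨ alive a → w ⊨ foldr (λ a r → alive a ∣∣ r) ff xs
      alive-among (here refl) alive (¬alive , _) = ¬alive alive
      alive-among (there a∈) alive (_ , ¬rest) = ¬rest (alive-among a∈ alive)

  axP-valid : ∀ B ne φ → Valid M (aliveSet B ne & deadSet (∁ B) & φ ⇒ D B ne (deadSet (∁ B) ⇒ φ))
  axP-valid B ne φ w Ww ((_ , dead∁B , wφ) , ¬□) = ¬□ λ w′ Ww′ sh (dead∁B′ , ¬w′φ) →
    let w⊑w′ = Shares⇒⊑ (W⊆S M w Ww) (deadSet∁⇒ColoursWithin B Ww dead∁B) sh
        w′⊑w = Shares⇒⊑ (W⊆S M w′ Ww′) (deadSet∁⇒ColoursWithin B Ww′ dead∁B′) (Shares-sym sh)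
    in ¬w′φ (⊨-resp-≐ φ (w⊑w′ , w′⊑w) wφ)

  axMin-valid : Minimal M → ∀ B ne → Valid M (aliveSet B ne & deadSet (∁ B) ⇒ D B ne (deadSet (∁ B)))
  axMin-valid minimal B ne w Ww ((_ , dead∁B) , ¬□) = ¬□ λ w′ Ww′ sh →
    let χw⊆B = deadSet∁⇒ColoursWithin B Ww dead∁B
        w⊑w′ = Shares⇒⊑ (W⊆S M w Ww) χw⊆B sh
        w′⊑w = proj₂ (proj₁ (minimal w) Ww) w′ (W⊆S M w′ Ww′) w⊑w′
    in ColoursWithin⇒deadSet∁ B λ v w′v → χw⊆B v (w′⊑w v w′v)

  axMax-valid : Maximal M → ∀ B ne → Valid M (aliveSet B ne ⇒ ~ D B ne (~ deadSet (∁ B)))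
  axMax-valid maximal B ne w Ww (alive , ¬¬◇dead) = aliveSet⇒¬¬Shares B ne alive λ sh →
    ¬¬◇dead λ □¬dead →
      □¬dead (w ↾ B) (proj₂ (maximal (w ↾ B)) (↾-face (W⊆S M w Ww) ne sh)) (Shares-↾ sh)
             (ColoursWithin⇒deadSet∁ B λ _ → proj₂)

module Soundness {n : ℕ} {AP : Set} (_≟_ : DecidableEquality (Fm n AP)) (M : SModel n AP) {L : Sys}
                 (minimal : L ≡ SCmin → Minimal M) (maximal : L ≡ SCmax → Maximal M) where

  open Semantics M

  sound : ∀ {φ} → Prov L φ → Valid M φ
  sound (taut tautφ)          = tautology-valid _≟_ tautφ
  sound (mp {ψ = ψ} ⊢φ⇒ψ ⊢φ) w Ww = ⇒-elim ψ (sound ⊢φ⇒ψ w Ww) (sound ⊢φ w Ww)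
  sound (nec B ne ⊢φ) w Ww w′ Ww′ _ = sound ⊢φ w′ Ww′
  sound (axK B ne φ ψ) w Ww (□φ⇒ψ , ¬[□φ⇒□ψ]) =
    ¬[□φ⇒□ψ] λ (□φ , ¬□ψ) → ¬□ψ λ w′ Ww′ sh → ⇒-elim ψ (□φ⇒ψ w′ Ww′ sh) (□φ w′ Ww′ sh)
  sound (axB B ne φ) w Ww (wφ , ¬□◇φ) = ¬□◇φ λ w′ _ sh □¬φ → □¬φ w Ww (Shares-sym sh) wφ
  sound (ax4 B ne φ) w Ww (□φ , ¬□□φ) =
    ¬□□φ λ w′ Ww′ sh w″ Ww″ sh′ → □φ w″ Ww″ (Shares-trans (W⊆S M w′ Ww′) sh sh′)
  sound (mono B B′ ne ne′ φ B⊆B′) w Ww (□φ , ¬□′φ) =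
    ¬□′φ λ w′ Ww′ sh → □φ w′ Ww′ (Shares-antimono B⊆B′ sh)
  sound (union B B′ ne ne′ ne″) = axUnion-valid B B′ ne ne′ ne″
  sound axNE                    = axNE-valid
  sound (axP B ne φ)            = axP-valid B ne φ
  sound (axMin L≡SCmin B ne _)  = axMin-valid (minimal L≡SCmin) B ne
  sound (axMax L≡SCmax B ne _)  = axMax-valid (maximal L≡SCmax) B ne

proposition19 : (n : ℕ) (AP : Set) → AP ↣ ℕ →
    ((φ : Fm n AP) → Prov SC φ → (M : SModel n AP) → Valid M φ)
    × ((φ : Fm n AP) → Prov SCmin φ → (M : SModel n AP) → Minimal M → Valid M φ)
    × ((φ : Fm n AP) → Prov SCmax φ → (M : SModel n AP) → Maximal M → Valid M φ)
proposition19 n AP AP↣ℕ =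
    (λ φ ⊢φ M → Soundness.sound _≟_ M (λ ()) (λ ()) ⊢φ)
  , (λ φ ⊢φ M minimal → Soundness.sound _≟_ M (λ _ → minimal) (λ ()) ⊢φ)
  , (λ φ ⊢φ M maximal → Soundness.sound _≟_ M (λ ()) (λ _ → maximal) ⊢φ)
  where
    _≟_ : DecidableEquality (Fm n AP)
    _≟_ = _≟ᶠᵐ_ (via-injection AP↣ℕ _≟ℕ_)
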